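{- Let $\mathcal T$ be a completed open tableau of $\mathbb T$, $\theta$ an open branch of $\mathcal T$, and $\Upsilon$ the set of signed formulas occurring on $\theta$. Let $h:Fm''\to M_4$ be a valuation such that for every propositional variable $p$: $h(p)\in\{\mathbf 1,\mathbf b\}$ if $T(p)\in\Upsilon$; $h(p)\in\{\mathbf 1,\mathbf n\}$ if $F(\neg p)\in\Upsilon$; $h(p)\in\{\mathbf 0,\mathbf n\}$ if $F(p)\in\Upsilon$; $h(p)\in\{\mathbf 0,\mathbf b\}$ if $T(\neg p)\in\Upsilon$ (and $h(p)$ arbitrary otherwise). Then for every formula $\alpha\in Fm''$: $h(\alpha)\in\{\mathbf 1,\mathbf b\}$ if $T(\alpha)\in\Upsilon$; $h(\alpha)\in\{\mathbf 1,\mathbf n\}$ if $F(\neg\alpha)\in\Upsilon$; $h(\alpha)\in\{\mathbf 0,\mathbf n\}$ if $F(\alpha)\in\Upsilon$; $h(\alpha)\in\{\mathbf 0,\mathbf b\}$ if $T(\neg\alpha)\in\Upsilon$.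
   Context: $M_4=\{\mathbf 0,\mathbf n,\mathbf b,\mathbf 1\}$ with $\neg\mathbf 0=\mathbf 1$, $\neg\mathbf 1=\mathbf 0$, $\neg\mathbf n=\mathbf n$, $\neg\mathbf b=\mathbf b$ and $\succ$: $\mathbf 0\succ y=\mathbf 1$; $\mathbf n\succ\mathbf 0=\mathbf n$, $\mathbf n\succ\mathbf n=\mathbf 1$, $\mathbf n\succ\mathbf b=\mathbf b$, $\mathbf n\succ\mathbf 1=\mathbf 1$; $\mathbf b\succ\mathbf 0=\mathbf b$, $\mathbf b\succ\mathbf n=\mathbf n$, $\mathbf b\succ\mathbf b=\mathbf 1$, $\mathbf b\succ\mathbf 1=\mathbf 1$; $\mathbf 1\succ y=y$. Formulas of $Fm''$ are built from propositional variables with $\neg$, $\succ$; a valuation is a homomorphism $h:Fm''\to M_4$. Signed formulas are $T(\alpha)$, $F(\alpha)$. Rules of $\mathbb T$ (premise $\Rightarrow$ conclusion sets separated by $|$): $T(\alpha\succ\beta)\Rightarrow \{T(\beta)\}\,|\,\{T(\neg\alpha),F(\beta),T(\neg\beta)\}\,|\,\{F(\alpha),F(\beta),F(\neg\beta)\}$; $F(\alpha\succ\beta)\Rightarrow\{T(\alpha),F(\beta),F(\neg\beta)\}\,|\,\{F(\neg\alpha),F(\beta),T(\neg\beta)\}$; $T(\neg(\alpha\succ\beta))\Rightarrow\{T(\alpha),F(\beta),T(\neg\beta)\}\,|\,\{F(\neg\alpha),T(\beta),T(\neg\beta)\}$; $F(\neg(\alpha\succ\beta))\Rightarrow\{F(\neg\beta)\}\,|\,\{T(\neg\alpha),T(\beta),T(\neg\beta)\}\,|\,\{F(\alpha),F(\beta),T(\neg\beta)\}$;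 $T(\neg\neg\alpha)\Rightarrow\{T(\alpha)\}$; $F(\neg\neg\alpha)\Rightarrow\{F(\alpha)\}$. A tableau is a finite tree of signed formulas built from a root by repeatedly choosing a non-closed branch and a signed formula on it that is a rule premise, and extending the branch by one sub-branch per conclusion set. A branch is closed if it contains $T(\gamma)$ and $F(\gamma)$ for some $\gamma$, open otherwise; a tableau is open if some branch is open; it is completed if on every non-closed branch every rule whose premise occurs on the branch has been applied to it along that branch. -}

module Defs where

open import Data.Nat using (ℕ)
open import Data.List using (List; []; _∷_; [_]; _++_; map)
open import Data.List.Membership.Propositional using (_∈_)
open import Data.Product using (∃; _×_)
open import Data.Sum using (_⊎_)
open import Relation.Nullary using (¬_)
open import Relation.Binary.PropositionalEquality using (_≡_)

data M4 : Set where
  𝟎 𝐧 𝐛 𝟏 : M4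

neg : M4 → M4
neg 𝟎 = 𝟏
neg 𝟏 = 𝟎
neg 𝐧 = 𝐧
neg 𝐛 = 𝐛

imp : M4 → M4 → M4
imp 𝟎 _ = 𝟏
imp 𝐧 𝟎 = 𝐧
imp 𝐧 𝐧 = 𝟏
imp 𝐧 𝐛 = 𝐛
imp 𝐧 𝟏 = 𝟏
imp 𝐛 𝟎 = 𝐛
imp 𝐛 𝐧 = 𝐧
imp 𝐛 𝐛 = 𝟏
imp 𝐛 𝟏 = 𝟏
imp 𝟏 y = y

infixr 5 _≻_
data Fm : Set where
  var : ℕ → Fm
  ~_  : Fm → Fm
  _≻_ : Fm → Fm → Fm

record IsValuation (h : Fm → M4) : Set where
  field
    hom-neg : ∀ α → h (~ α) ≡ neg (h α)
    hom-imp : ∀ α β → h (α ≻ β) ≡ imp (h α) (h β)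

data SF : Set where
  T F : Fm → SF

-- rule s = list of conclusion sets of the rule with premise s
-- ([] exactly when s is not a premise of any rule)
rule : SF → List (List SF)
rule (T (α ≻ β)) =
  [ T β ] ∷ (T (~ α) ∷ F β ∷ T (~ β) ∷ []) ∷ (F α ∷ F β ∷ F (~ β) ∷ []) ∷ []
rule (F (α ≻ β)) =
  (T α ∷ F β ∷ F (~ β) ∷ []) ∷ (F (~ α) ∷ F β ∷ T (~ β) ∷ []) ∷ []
rule (T (~ (α ≻ β))) =
  (T α ∷ F β ∷ T (~ β) ∷ []) ∷ (F (~ α) ∷ T β ∷ T (~ β) ∷ []) ∷ []
rule (F (~ (α ≻ β))) =
  [ F (~ β) ] ∷ (T (~ α) ∷ T β ∷ T (~ β) ∷ []) ∷ (F α ∷ F β ∷ T (~ β) ∷ []) ∷ []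
rule (T (~ (~ α))) = [ [ T α ] ]
rule (F (~ (~ α))) = [ [ F α ] ]
rule _ = []

IsPremise : SF → Set
IsPremise s = ¬ (rule s ≡ [])

-- A branch: the signed formulas on it (root first) together with the
-- premises to which a rule has been applied along it.
record Branch : Set where
  constructor ⟨_,_⟩
  field
    forms : List SF
    used  : List SF
open Branch public

Closed : Branch → Set
Closed θ = ∃ λ γ → (T γ ∈ forms θ) × (F γ ∈ forms θ)

extend : Branch → SF → List SF → Branch
extend θ s cs = ⟨ forms θ ++ cs , s ∷ used θ ⟩

-- Tableau r bs : the finite tree with root r whose list of branches is bs,
-- built by repeatedly choosing a non-closed branch and a rule premise on it,
-- and extending the branch by one sub-branch per conclusion set.
data Tableau (r : SF) : List Branch → Set where
  start : Tableau r [ ⟨ [ r ] , [] ⟩ ]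
  step  : (pre post : List Branch) (θ : Branch) (s : SF) →
          Tableau r (pre ++ θ ∷ post) →
          ¬ Closed θ → s ∈ forms θ → IsPremise s →
          Tableau r (pre ++ map (extend θ s) (rule s) ++ post)

OpenTableau : List Branch → Set
OpenTableau bs = ∃ λ θ → θ ∈ bs × ¬ Closed θ

Completed : List Branch → Set
Completed bs = ∀ θ → θ ∈ bs → ¬ Closed θ →
  ∀ s → s ∈ forms θ → IsPremise s → s ∈ used θ

Cond : List SF → (Fm → M4) → Fm → Set
Cond Υ h α =
  (T α ∈ Υ → h α ≡ 𝟏 ⊎ h α ≡ 𝐛) ×
  (F (~ α) ∈ Υ → h α ≡ 𝟏 ⊎ h α ≡ 𝐧) ×
  (F α ∈ Υ → h α ≡ 𝟎 ⊎ h α ≡ 𝐧) ×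
  (T (~ α) ∈ Υ → h α ≡ 𝟎 ⊎ h α ≡ 𝐛)

-- A completed open branch is downward saturated: each rule premise on it has
-- one whole conclusion set on it. Every rule of 𝕋 is sound read upwards in M₄
-- (if h satisfies a conclusion set it satisfies the premise, a finite check on
-- the truth tables), and every conclusion is lighter than its premise, so by
-- well-founded induction h satisfies every signed formula on the branch as soon
-- as it satisfies the literals T(p), F(p), T(¬p), F(¬p). The four conditions
-- of the theorem are this satisfaction, read through the truth table of ¬.
module Submission where

open import Defs
open import Data.Nat using (ℕ; suc; _+_; _<_; s≤s)
open import Data.Nat.Properties using (m≤m+n; m≤n+m; n<1+n; m<n⇒m<1+n)
open import Data.Nat.Induction using (<-wellFounded)
open import Data.List using (List; map)
open import Data.List.Membership.Propositional using (_∈_)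
open import Data.List.Membership.Propositional.Properties using (∈-++⁺ˡ; ∈-++⁺ʳ; ∈-++⁻; ∈-map⁻)
open import Data.List.Relation.Binary.Subset.Propositional using (_⊆_)
open import Data.List.Relation.Unary.All as All using (All; []; _∷_)
open import Data.List.Relation.Unary.Any using (here; there)
open import Data.Product using (∃; _×_; _,_; proj₁; proj₂)
open import Data.Sum using (_⊎_; inj₁; inj₂)
open import Induction.WellFounded using (Acc; acc)
open import Relation.Nullary using (¬_; Dec; yes; no)
open import Relation.Nullary.Decidable using (True; toWitness; _→-dec_; _×-dec_; _⊎-dec_)
open import Relation.Binary.PropositionalEquality using (_≡_; refl; subst)

Designated Undesignated : M4 → Set
Designated x   = x ≡ 𝟏 ⊎ x ≡ 𝐛
Undesignated x = x ≡ 𝟎 ⊎ x ≡ 𝐧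

designated? : ∀ x → Dec (Designated x)
designated? 𝟎 = no λ { (inj₁ ()) ; (inj₂ ()) }
designated? 𝐧 = no λ { (inj₁ ()) ; (inj₂ ()) }
designated? 𝐛 = yes (inj₂ refl)
designated? 𝟏 = yes (inj₁ refl)

undesignated? : ∀ x → Dec (Undesignated x)
undesignated? 𝟎 = yes (inj₁ refl)
undesignated? 𝐧 = yes (inj₂ refl)
undesignated? 𝐛 = no λ { (inj₁ ()) ; (inj₂ ()) }
undesignated? 𝟏 = no λ { (inj₁ ()) ; (inj₂ ()) }

designated-neg⁻ : ∀ x → Designated (neg x) → x ≡ 𝟎 ⊎ x ≡ 𝐛
designated-neg⁻ 𝟎 _ = inj₁ refl
designated-neg⁻ 𝐛 _ = inj₂ refl
designated-neg⁻ 𝐧 (inj₁ ())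
designated-neg⁻ 𝐧 (inj₂ ())
designated-neg⁻ 𝟏 (inj₁ ())
designated-neg⁻ 𝟏 (inj₂ ())

designated-neg⁺ : ∀ {x} → x ≡ 𝟎 ⊎ x ≡ 𝐛 → Designated (neg x)
designated-neg⁺ (inj₁ refl) = inj₁ refl
designated-neg⁺ (inj₂ refl) = inj₂ refl

undesignated-neg⁻ : ∀ x → Undesignated (neg x) → x ≡ 𝟏 ⊎ x ≡ 𝐧
undesignated-neg⁻ 𝟏 _ = inj₁ refl
undesignated-neg⁻ 𝐧 _ = inj₂ refl
undesignated-neg⁻ 𝟎 (inj₁ ())
undesignated-neg⁻ 𝟎 (inj₂ ())
undesignated-neg⁻ 𝐛 (inj₁ ())
undesignated-neg⁻ 𝐛 (inj₂ ())

undesignated-neg⁺ : ∀ {x} → x ≡ 𝟏 ⊎ x ≡ 𝐧 → Undesignated (neg x)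
undesignated-neg⁺ (inj₁ refl) = inj₁ refl
undesignated-neg⁺ (inj₂ refl) = inj₂ refl

Everywhere : (M4 → Set) → Set
Everywhere P = P 𝟎 × P 𝐧 × P 𝐛 × P 𝟏

everywhere : (P : M4 → Set) → Everywhere P → ∀ x → P x
everywhere P (p , _ , _ , _) 𝟎 = p
everywhere P (_ , p , _ , _) 𝐧 = p
everywhere P (_ , _ , p , _) 𝐛 = p
everywhere P (_ , _ , _ , p) 𝟏 = p

-- The implicit table is a nested tuple of ⊤, found by η as soon as all
-- sixteen instances of P? evaluate to yes.
by-truth-table : ∀ {P : M4 → M4 → Set} (P? : ∀ x y → Dec (P x y)) →
  {_ : Everywhere λ x → Everywhere λ y → True (P? x y)} → ∀ x y → P x y
by-truth-table P? {table} x y =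
  toWitness (everywhere (λ y → True (P? x y))
                        (everywhere (λ x → Everywhere λ y → True (P? x y)) table x) y)

imp-designated : ∀ x y →
  Designated y ⊎ Designated (neg x) × Undesignated y × Designated (neg y)
               ⊎ Undesignated x × Undesignated y × Undesignated (neg y) →
  Designated (imp x y)
imp-designated = by-truth-table λ x y →
  (designated? y ⊎-dec designated? (neg x) ×-dec undesignated? y ×-dec designated? (neg y)
                 ⊎-dec undesignated? x ×-dec undesignated? y ×-dec undesignated? (neg y))
  →-dec designated? (imp x y)

imp-undesignated : ∀ x y →
  Designated x × Undesignated y × Undesignated (neg y)
    ⊎ Undesignated (neg x) × Undesignated y × Designated (neg y) →
  Undesignated (imp x y)
imp-undesignated = by-truth-table λ x y →
  (designated? x ×-dec undesignated? y ×-dec undesignated? (neg y)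
     ⊎-dec undesignated? (neg x) ×-dec undesignated? y ×-dec designated? (neg y))
  →-dec undesignated? (imp x y)

neg-imp-designated : ∀ x y →
  Designated x × Undesignated y × Designated (neg y)
    ⊎ Undesignated (neg x) × Designated y × Designated (neg y) →
  Designated (neg (imp x y))
neg-imp-designated = by-truth-table λ x y →
  (designated? x ×-dec undesignated? y ×-dec designated? (neg y)
     ⊎-dec undesignated? (neg x) ×-dec designated? y ×-dec designated? (neg y))
  →-dec designated? (neg (imp x y))

neg-imp-undesignated : ∀ x y →
  Undesignated (neg y) ⊎ Designated (neg x) × Designated y × Designated (neg y)
                       ⊎ Undesignated x × Undesignated y × Designated (neg y) →
  Undesignated (neg (imp x y))
neg-imp-undesignated = by-truth-table λ x y →
  (undesignated? (neg y) ⊎-dec designated? (neg x) ×-dec designated? y ×-dec designated? (neg y)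
                         ⊎-dec undesignated? x ×-dec undesignated? y ×-dec designated? (neg y))
  →-dec undesignated? (neg (imp x y))

neg-neg : ∀ x → neg (neg x) ≡ x
neg-neg 𝟎 = refl
neg-neg 𝐧 = refl
neg-neg 𝐛 = refl
neg-neg 𝟏 = refl

infix 4 _⊨_
_⊨_ : (Fm → M4) → SF → Set
h ⊨ T α = Designated (h α)
h ⊨ F α = Undesignated (h α)

module _ {h : Fm → M4} (V : IsValuation h) where
  open IsValuation V

  rule-reflects : ∀ s {c} → c ∈ rule s → All (h ⊨_) c → h ⊨ s
  rule-reflects (T (α ≻ β)) (here refl) (d ∷ [])
    rewrite hom-imp α β = imp-designated _ _ (inj₁ d)
  rule-reflects (T (α ≻ β)) (there (here refl)) (d ∷ u ∷ d′ ∷ [])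
    rewrite hom-imp α β | hom-neg α | hom-neg β = imp-designated _ _ (inj₂ (inj₁ (d , u , d′)))
  rule-reflects (T (α ≻ β)) (there (there (here refl))) (u ∷ u′ ∷ u″ ∷ [])
    rewrite hom-imp α β | hom-neg β = imp-designated _ _ (inj₂ (inj₂ (u , u′ , u″)))
  rule-reflects (F (α ≻ β)) (here refl) (d ∷ u ∷ u′ ∷ [])
    rewrite hom-imp α β | hom-neg β = imp-undesignated _ _ (inj₁ (d , u , u′))
  rule-reflects (F (α ≻ β)) (there (here refl)) (u ∷ u′ ∷ d ∷ [])
    rewrite hom-imp α β | hom-neg α | hom-neg β = imp-undesignated _ _ (inj₂ (u , u′ , d))
  rule-reflects (T (~ (α ≻ β))) (here refl) (d ∷ u ∷ d′ ∷ [])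
    rewrite hom-neg (α ≻ β) | hom-imp α β | hom-neg β = neg-imp-designated _ _ (inj₁ (d , u , d′))
  rule-reflects (T (~ (α ≻ β))) (there (here refl)) (u ∷ d ∷ d′ ∷ [])
    rewrite hom-neg (α ≻ β) | hom-imp α β | hom-neg α | hom-neg β =
      neg-imp-designated _ _ (inj₂ (u , d , d′))
  rule-reflects (F (~ (α ≻ β))) (here refl) (u ∷ [])
    rewrite hom-neg (α ≻ β) | hom-imp α β | hom-neg β = neg-imp-undesignated _ _ (inj₁ u)
  rule-reflects (F (~ (α ≻ β))) (there (here refl)) (d ∷ d′ ∷ d″ ∷ [])
    rewrite hom-neg (α ≻ β) | hom-imp α β | hom-neg α | hom-neg β =
      neg-imp-undesignated _ _ (inj₂ (inj₁ (d , d′ , d″)))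
  rule-reflects (F (~ (α ≻ β))) (there (there (here refl))) (u ∷ u′ ∷ d ∷ [])
    rewrite hom-neg (α ≻ β) | hom-imp α β | hom-neg β =
      neg-imp-undesignated _ _ (inj₂ (inj₂ (u , u′ , d)))
  rule-reflects (T (~ (~ α))) (here refl) (d ∷ [])
    rewrite hom-neg (~ α) | hom-neg α | neg-neg (h α) = d
  rule-reflects (F (~ (~ α))) (here refl) (u ∷ [])
    rewrite hom-neg (~ α) | hom-neg α | neg-neg (h α) = u

-- ≻ weighs two, so that ¬α and ¬β are lighter than α ≻ β.
weight : Fm → ℕ
weight (var _) = 0
weight (~ α)   = suc (weight α)
weight (α ≻ β) = suc (suc (weight α + weight β))

weightˢ : SF → ℕ
weightˢ (T α) = weight α
weightˢ (F α) = weight α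

module _ {α β : Fm} where
  ~ˡ<≻ : weight (~ α) < weight (α ≻ β)
  ~ˡ<≻ = s≤s (s≤s (m≤m+n (weight α) (weight β)))

  ~ʳ<≻ : weight (~ β) < weight (α ≻ β)
  ~ʳ<≻ = s≤s (s≤s (m≤n+m (weight β) (weight α)))

  ˡ<≻ : weight α < weight (α ≻ β)
  ˡ<≻ = m<n⇒m<1+n (s≤s (m≤m+n (weight α) (weight β)))

  ʳ<≻ : weight β < weight (α ≻ β)
  ʳ<≻ = m<n⇒m<1+n (s≤s (m≤n+m (weight β) (weight α)))

rule-decreasing : ∀ s {c} → c ∈ rule s → All (λ t → weightˢ t < weightˢ s) c
rule-decreasing (T (α ≻ β)) (here refl) = ʳ<≻ ∷ []
rule-decreasing (T (α ≻ β)) (there (here refl)) = ~ˡ<≻ ∷ ʳ<≻ ∷ ~ʳ<≻ ∷ []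
rule-decreasing (T (α ≻ β)) (there (there (here refl))) = ˡ<≻ ∷ ʳ<≻ ∷ ~ʳ<≻ ∷ []
rule-decreasing (F (α ≻ β)) (here refl) = ˡ<≻ ∷ ʳ<≻ ∷ ~ʳ<≻ ∷ []
rule-decreasing (F (α ≻ β)) (there (here refl)) = ~ˡ<≻ ∷ ʳ<≻ ∷ ~ʳ<≻ ∷ []
rule-decreasing (T (~ (α ≻ β))) (here refl) =
  All.map m<n⇒m<1+n (ˡ<≻ ∷ ʳ<≻ ∷ ~ʳ<≻ ∷ [])
rule-decreasing (T (~ (α ≻ β))) (there (here refl)) =
  All.map m<n⇒m<1+n (~ˡ<≻ ∷ ʳ<≻ ∷ ~ʳ<≻ ∷ [])
rule-decreasing (F (~ (α ≻ β))) (here refl) = All.map m<n⇒m<1+n (~ʳ<≻ ∷ [])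
rule-decreasing (F (~ (α ≻ β))) (there (here refl)) =
  All.map m<n⇒m<1+n (~ˡ<≻ ∷ ʳ<≻ ∷ ~ʳ<≻ ∷ [])
rule-decreasing (F (~ (α ≻ β))) (there (there (here refl))) =
  All.map m<n⇒m<1+n (ˡ<≻ ∷ ʳ<≻ ∷ ~ʳ<≻ ∷ [])
rule-decreasing (T (~ (~ α))) (here refl) = m<n⇒m<1+n (n<1+n _) ∷ []
rule-decreasing (F (~ (~ α))) (here refl) = m<n⇒m<1+n (n<1+n _) ∷ []

data Literal : SF → Set where
  T-var  : ∀ p → Literal (T (var p))
  F-var  : ∀ p → Literal (F (var p))
  T-~var : ∀ p → Literal (T (~ var p))
  F-~var : ∀ p → Literal (F (~ var p))

literal-or-premise : ∀ s → Literal s ⊎ IsPremise s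
literal-or-premise (T (var p))       = inj₁ (T-var p)
literal-or-premise (T (~ var p))     = inj₁ (T-~var p)
literal-or-premise (T (~ (~ α)))     = inj₂ λ ()
literal-or-premise (T (~ (α ≻ β)))   = inj₂ λ ()
literal-or-premise (T (α ≻ β))       = inj₂ λ ()
literal-or-premise (F (var p))       = inj₁ (F-var p)
literal-or-premise (F (~ var p))     = inj₁ (F-~var p)
literal-or-premise (F (~ (~ α)))     = inj₂ λ ()
literal-or-premise (F (~ (α ≻ β)))   = inj₂ λ ()
literal-or-premise (F (α ≻ β))       = inj₂ λ ()

Fulfilled : List SF → SF → Set
Fulfilled Υ s = ∃ λ c → c ∈ rule s × c ⊆ Υ

fulfilled-mono : ∀ {Υ Υ′ s} → Υ ⊆ Υ′ → Fulfilled Υ s → Fulfilled Υ′ s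
fulfilled-mono Υ⊆Υ′ (c , c∈ , c⊆Υ) = c , c∈ , λ t∈ → Υ⊆Υ′ (c⊆Υ t∈)

Saturated : List SF → Set
Saturated Υ = ∀ {s} → s ∈ Υ → IsPremise s → Fulfilled Υ s

module _ {Υ : List SF} {h : Fm → M4} (V : IsValuation h) (saturated : Saturated Υ)
         (satisfies-literals : ∀ {s} → Literal s → s ∈ Υ → h ⊨ s) where

  satisfied-acc : ∀ s → Acc _<_ (weightˢ s) → s ∈ Υ → h ⊨ s
  satisfied-acc s (acc lighter) s∈Υ with literal-or-premise s
  ... | inj₁ literal = satisfies-literals literal s∈Υ
  ... | inj₂ premise with saturated s∈Υ premise
  ...   | c , c∈rule , c⊆Υ = rule-reflects V s c∈rule (All.tabulate λ t∈c →
            satisfied-acc _ (lighter (All.lookup (rule-decreasing s c∈rule) t∈c)) (c⊆Υ t∈c))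

  saturated-satisfied : ∀ {s} → s ∈ Υ → h ⊨ s
  saturated-satisfied {s} = satisfied-acc s (<-wellFounded (weightˢ s))

UsedFulfilled : Branch → Set
UsedFulfilled θ = ∀ {s} → s ∈ used θ → Fulfilled (forms θ) s

extend-used-fulfilled : ∀ {θ s c} → c ∈ rule s → UsedFulfilled θ → UsedFulfilled (extend θ s c)
extend-used-fulfilled {θ} c∈rule _ (here refl) = _ , c∈rule , ∈-++⁺ʳ (forms θ)
extend-used-fulfilled _ fulfilled (there u∈) = fulfilled-mono ∈-++⁺ˡ (fulfilled u∈)

tableau-used-fulfilled : ∀ {r bs θ} → Tableau r bs → θ ∈ bs → UsedFulfilled θ
tableau-used-fulfilled start (here refl) ()
tableau-used-fulfilled (step pre post θ s tab _ _ _) θ′∈ with ∈-++⁻ pre θ′∈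
... | inj₁ θ′∈pre = tableau-used-fulfilled tab (∈-++⁺ˡ θ′∈pre)
... | inj₂ θ′∈rest with ∈-++⁻ (map (extend θ s) (rule s)) θ′∈rest
...   | inj₂ θ′∈post = tableau-used-fulfilled tab (∈-++⁺ʳ pre (there θ′∈post))
...   | inj₁ θ′∈new with ∈-map⁻ (extend θ s) θ′∈new
...     | c , c∈rule , refl =
          extend-used-fulfilled c∈rule (tableau-used-fulfilled tab (∈-++⁺ʳ pre (here refl)))

completed-open-branch-saturated : ∀ {r bs θ} → Tableau r bs → Completed bs →
  θ ∈ bs → ¬ Closed θ → Saturated (forms θ)
completed-open-branch-saturated tab completed θ∈ θ-open s∈ premise =
  tableau-used-fulfilled tab θ∈ (completed _ θ∈ θ-open _ s∈ premise)

module _ {Υ : List SF} {h : Fm → M4} (V : IsValuation h) where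
  open IsValuation V

  cond⇒literals-satisfied : (∀ p → Cond Υ h (var p)) → ∀ {s} → Literal s → s ∈ Υ → h ⊨ s
  cond⇒literals-satisfied cond (T-var p) = proj₁ (cond p)
  cond⇒literals-satisfied cond (F-var p) = proj₁ (proj₂ (proj₂ (cond p)))
  cond⇒literals-satisfied cond (T-~var p) s∈ rewrite hom-neg (var p) =
    designated-neg⁺ (proj₂ (proj₂ (proj₂ (cond p))) s∈)
  cond⇒literals-satisfied cond (F-~var p) s∈ rewrite hom-neg (var p) =
    undesignated-neg⁺ (proj₁ (proj₂ (cond p)) s∈)

  satisfied⇒cond : (∀ {s} → s ∈ Υ → h ⊨ s) → ∀ α → Cond Υ h α
  satisfied⇒cond satisfied α =
      satisfied
    , (λ F~α∈ → undesignated-neg⁻ (h α) (subst Undesignated (hom-neg α) (satisfied F~α∈)))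
    , satisfied
    , (λ T~α∈ → designated-neg⁻ (h α) (subst Designated (hom-neg α) (satisfied T~α∈)))

proposition5p6 : (r : SF) (bs : List Branch) → Tableau r bs →
    Completed bs → OpenTableau bs →
    (θ : Branch) → θ ∈ bs → ¬ Closed θ →
    (h : Fm → M4) → IsValuation h →
    (∀ (p : ℕ) → Cond (forms θ) h (var p)) →
    ∀ (α : Fm) → Cond (forms θ) h α
proposition5p6 _ _ tab completed _ θ θ∈ θ-open h V cond-vars =
  satisfied⇒cond V (saturated-satisfied V saturated (cond⇒literals-satisfied V cond-vars))
  where
  saturated : Saturated (forms θ)
  saturated = completed-open-branch-saturated tab completed θ∈ θ-open
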